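{- Let $k\geq 1$ and $n=t_k=\frac{k(k+1)}{2}$. Then the maximum number of edges of a locally irregular graph of order $n$ is exactly $m_k:=\frac{k(k+1)(k-1)(3k+2)}{24}$.
   Context: All graphs are finite and simple. A graph is locally irregular if no two adjacent vertices have the same degree. $t_k$ denotes the $k$-th triangular number $1+2+\dots+k$. -}

module Defs where

open import Data.Nat using (ℕ; zero; suc; _+_; _*_; _∸_; _<_)
open import Data.Nat.DivMod using (_/_)
open import Data.Bool using (Bool; true; false; T)
open import Data.Fin using (Fin; toℕ)
open import Data.List using (List; length; filter; allFin; map)
open import Data.Nat.ListAction using (sum)
open import Data.Bool.Properties using (T?)
open import Data.Bool using (_∧_)
open import Data.Product using (Σ; _×_; _,_)
open import Relation.Binary.PropositionalEquality using (_≡_)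
open import Relation.Nullary using (¬_)
open import Data.Nat.Properties using (_<?_)
open import Relation.Nullary.Decidable using (does)

t : ℕ → ℕ
t zero = 0
t (suc k) = suc k + t k

record Graph (n : ℕ) : Set where
  field
    adj   : Fin n → Fin n → Bool
    sym   : ∀ i j → adj i j ≡ adj j i
    irrefl : ∀ i → adj i i ≡ false
open Graph public

deg : ∀ {n} → Graph n → Fin n → ℕ
deg G v = length (filter (λ u → T? (adj G v u)) (allFin _))

edgeCount : ∀ {n} → Graph n → ℕ
edgeCount {n} G =
  sum (map (λ i →
    length (filter (λ j → T? (does (toℕ i <? toℕ j) ∧ adj G i j)) (allFin n)))
    (allFin n))

LocallyIrregular : ∀ {n} → Graph n → Set
LocallyIrregular G = ∀ u v → T (adj G u v) → ¬ (deg G u ≡ deg G v)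

m : ℕ → ℕ
m k = (k * (k + 1) * (k ∸ 1) * (3 * k + 2)) / 24

{-# OPTIONS --safe #-}
-- In a locally irregular graph on n vertices, vertices of equal degree are pairwise
-- non-adjacent, so a vertex of codegree a = n − deg is non-adjacent to every vertex of
-- codegree a, itself included: at most a vertices have codegree a.  For n = t k the
-- codegrees therefore sum to at least 1² + 2² + ⋯ + k², and the handshake lemma gives
-- 2 |E| = n² − Σ codegree ≤ t k ² − (1² + ⋯ + k²) = 2 m k.  The complete multipartite
-- graph K_{1,2,…,k} attains the bound: a vertex in the part of size s has degree n − s,
-- so vertices in different parts, i.e. adjacent ones, have different degrees.
module Submission where

open import Defs
open import Data.Nat using (ℕ; _≤_)
open import Data.Product using (Σ; _×_)
open import Relation.Binary.PropositionalEquality using (_≡_)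

open import Data.Bool using (Bool; true; false; T; not; _∧_)
open import Data.Bool.Properties using (T?)
open import Data.Fin using (Fin; zero; suc; toℕ; splitAt)
open import Data.Fin.Properties using (any?) renaming (<-cmp to <-cmpᶠ)
open import Data.List using (length; filter; map; tabulate; allFin)
open import Data.List.Properties using (length-filter; length-tabulate)
import Data.Nat.ListAction as List
open import Data.Nat using (zero; suc; _+_; _*_; _∸_; _<_; _≡ᵇ_; _<ᵇ_; _<?_; z≤n; s≤s)
open import Data.Nat.DivMod using (_/_; m*n/n≡m)
open import Data.Nat.Properties
open import Data.Nat.Tactic.RingSolver using (solve-∀)
open import Data.Product using (_,_)
open import Data.Sum using (inj₁; inj₂; [_,_])
open import Data.Sum.Properties using ([,]-∘; [,]-map)
open import Data.Vec.Functional using (Vector; replicate; _++_)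
open import Function using (_∘_; id)
open import Relation.Binary using (tri<; tri≈; tri>)
open import Relation.Binary.PropositionalEquality
  using (_≢_; refl; trans; cong; cong₂; subst; module ≡-Reasoning)
  renaming (sym to ≡-sym)
open import Relation.Nullary using (¬_; yes; no; does; contradiction)
open import Relation.Nullary.Decidable using (dec-true; dec-false)

open import Algebra.Properties.CommutativeMonoid.Sum +-0-commutativeMonoid
  using (sum; sum-syntax; sum-cong-≗; sum-replicate-zero; ∑-distrib-+; ∑-comm)

𝟙 : Bool → ℕ
𝟙 true  = 1
𝟙 false = 0

𝟙-false : ∀ {b} → ¬ T b → 𝟙 b ≡ 0
𝟙-false {true}  ¬b = contradiction _ ¬b
𝟙-false {false} _  = refl

𝟙-not+𝟙 : ∀ b → 𝟙 (not b) + 𝟙 b ≡ 1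
𝟙-not+𝟙 true  = refl
𝟙-not+𝟙 false = refl

≡ᵇ-refl : ∀ m → (m ≡ᵇ m) ≡ true
≡ᵇ-refl zero    = refl
≡ᵇ-refl (suc m) = ≡ᵇ-refl m

≡ᵇ-sym : ∀ m n → (m ≡ᵇ n) ≡ (n ≡ᵇ m)
≡ᵇ-sym zero    zero    = refl
≡ᵇ-sym zero    (suc n) = refl
≡ᵇ-sym (suc m) zero    = refl
≡ᵇ-sym (suc m) (suc n) = ≡ᵇ-sym m n

𝟙-≡ᵇ-≢ : ∀ {m n} → m ≢ n → 𝟙 (m ≡ᵇ n) ≡ 0
𝟙-≡ᵇ-≢ {m} {n} m≢n = 𝟙-false (m≢n ∘ ≡ᵇ⇒≡ m n)

𝟙-<ᵇ-suc : ∀ m n → 𝟙 (m <ᵇ suc n) ≡ 𝟙 (m ≡ᵇ n) + 𝟙 (m <ᵇ n)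
𝟙-<ᵇ-suc zero    zero    = refl
𝟙-<ᵇ-suc zero    (suc n) = refl
𝟙-<ᵇ-suc (suc m) zero    = refl
𝟙-<ᵇ-suc (suc m) (suc n) = 𝟙-<ᵇ-suc m n

suc-∸ : ∀ m n → suc n ∸ m ≡ 𝟙 (m <ᵇ suc n) + (n ∸ m)
suc-∸ zero    n       = refl
suc-∸ (suc m) zero    = 0∸n≡0 m
suc-∸ (suc m) (suc n) = suc-∸ m n

∑-mono-≤ : ∀ {n} {f g : Vector ℕ n} → (∀ i → f i ≤ g i) → sum f ≤ sum g
∑-mono-≤ {zero}  f≤g = z≤n
∑-mono-≤ {suc n} f≤g = +-mono-≤ (f≤g zero) (∑-mono-≤ (f≤g ∘ suc))

∑-const : ∀ n c → ∑[ i < n ] c ≡ n * c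
∑-const zero    c = refl
∑-const (suc n) c = cong (c +_) (∑-const n c)

∑-zero : ∀ {n} {f : Vector ℕ n} → (∀ i → f i ≡ 0) → sum f ≡ 0
∑-zero {n} f≡0 = trans (sum-cong-≗ f≡0) (sum-replicate-zero n)

∑-++ : ∀ {m n} (xs : Vector ℕ m) (ys : Vector ℕ n) → sum (xs ++ ys) ≡ sum xs + sum ys
∑-++ {zero}  xs ys = refl
∑-++ {suc m} xs ys = begin
  xs zero + sum ((xs ++ ys) ∘ suc)     ≡⟨ cong (xs zero +_) (sum-cong-≗ ([,]-map ∘ splitAt m)) ⟩
  xs zero + sum ((xs ∘ suc) ++ ys)     ≡⟨ cong (xs zero +_) (∑-++ (xs ∘ suc) ys) ⟩
  xs zero + (sum (xs ∘ suc) + sum ys)  ≡⟨ +-assoc (xs zero) _ _ ⟨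
  sum xs + sum ys                      ∎
  where open ≡-Reasoning

sum-map-tabulate : ∀ {A : Set} {n} (f : A → ℕ) (g : Fin n → A) →
                   List.sum (map f (tabulate g)) ≡ ∑[ i < n ] f (g i)
sum-map-tabulate {n = zero}  f g = refl
sum-map-tabulate {n = suc n} f g = cong (f (g zero) +_) (sum-map-tabulate f (g ∘ suc))

length-filter-tabulate : ∀ {A : Set} {n} (b : A → Bool) (g : Fin n → A) →
                         length (filter (T? ∘ b) (tabulate g)) ≡ ∑[ i < n ] 𝟙 (b (g i))
length-filter-tabulate {n = zero}  b g = refl
length-filter-tabulate {n = suc n} b g with b (g zero)
... | true  = cong suc (length-filter-tabulate b (g ∘ suc))
... | false = length-filter-tabulate b (g ∘ suc)

-- tetrahedral k = t 0 + ⋯ + t (k − 1), one index behind the usual tetrahedral numbers.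
tetrahedral : ℕ → ℕ
tetrahedral zero    = 0
tetrahedral (suc k) = t k + tetrahedral k

sumSquares : ℕ → ℕ
sumSquares zero    = 0
sumSquares (suc k) = suc k * suc k + sumSquares k

k*t≡sumSquares+tetrahedral : ∀ k → k * t k ≡ sumSquares k + tetrahedral k
k*t≡sumSquares+tetrahedral zero    = refl
k*t≡sumSquares+tetrahedral (suc k) = begin
  suc k * (suc k + t k)
    ≡⟨ expand k (t k) ⟩
  suc k * suc k + (k * t k + t k)
    ≡⟨ cong (λ x → suc k * suc k + (x + t k)) (k*t≡sumSquares+tetrahedral k) ⟩
  suc k * suc k + (sumSquares k + tetrahedral k + t k)
    ≡⟨ regroup (suc k * suc k) (sumSquares k) (tetrahedral k) (t k) ⟩
  (suc k * suc k + sumSquares k) + (t k + tetrahedral k)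
    ∎
  where
  open ≡-Reasoning
  expand : ∀ k x → suc k * (suc k + x) ≡ suc k * suc k + (k * x + x)
  expand = solve-∀
  regroup : ∀ a b c d → a + (b + c + d) ≡ (a + b) + (d + c)
  regroup = solve-∀

-- The edges of K_{1,2,…,k}: the part of size k + 1 is joined to the t k vertices of the others.
multipartiteEdges : ℕ → ℕ
multipartiteEdges zero    = 0
multipartiteEdges (suc k) = suc k * t k + multipartiteEdges k

2*multipartiteEdges+sumSquares≡t² : ∀ k → 2 * multipartiteEdges k + sumSquares k ≡ t k * t k
2*multipartiteEdges+sumSquares≡t² zero    = refl
2*multipartiteEdges+sumSquares≡t² (suc k) = begin
  2 * (suc k * t k + E) + (suc k * suc k + S)
    ≡⟨ regroup (suc k * t k) E (suc k * suc k) S ⟩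
  suc k * suc k + 2 * (suc k * t k) + (2 * E + S)
    ≡⟨ cong (suc k * suc k + 2 * (suc k * t k) +_) (2*multipartiteEdges+sumSquares≡t² k) ⟩
  suc k * suc k + 2 * (suc k * t k) + t k * t k
    ≡⟨ square (suc k) (t k) ⟩
  (suc k + t k) * (suc k + t k)
    ∎
  where
  open ≡-Reasoning
  S E : ℕ
  S = sumSquares k
  E = multipartiteEdges k
  regroup : ∀ b e a s → 2 * (b + e) + (a + s) ≡ a + 2 * b + (2 * e + s)
  regroup = solve-∀
  square : ∀ a b → a * a + 2 * (a * b) + b * b ≡ (a + b) * (a + b)
  square = solve-∀

2*t≡k*[k+1] : ∀ k → 2 * t k ≡ k * suc k
2*t≡k*[k+1] zero    = refl
2*t≡k*[k+1] (suc k) = begin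
  2 * (suc k + t k)          ≡⟨ *-distribˡ-+ 2 (suc k) (t k) ⟩
  2 * suc k + 2 * t k        ≡⟨ cong (2 * suc k +_) (2*t≡k*[k+1] k) ⟩
  2 * suc k + k * suc k      ≡⟨ *-distribʳ-+ (suc k) 2 k ⟨
  (2 + k) * suc k            ≡⟨ *-comm (2 + k) (suc k) ⟩
  suc k * suc (suc k)        ∎
  where open ≡-Reasoning

-- Stated at suc k, where the factor k ∸ 1 of m is a plain k.
multipartiteEdges-suc*24 : ∀ k → multipartiteEdges (suc k) * 24 ≡ suc k * (suc k + 1) * k * (3 * suc k + 2)
multipartiteEdges-suc*24 zero    = refl
multipartiteEdges-suc*24 (suc k) = begin
  (suc (suc k) * t (suc k) + multipartiteEdges (suc k)) * 24
    ≡⟨ expand (suc (suc k)) (t (suc k)) (multipartiteEdges (suc k)) ⟩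
  12 * suc (suc k) * (2 * t (suc k)) + multipartiteEdges (suc k) * 24
    ≡⟨ cong₂ (λ x y → 12 * suc (suc k) * x + y) (2*t≡k*[k+1] (suc k)) (multipartiteEdges-suc*24 k) ⟩
  12 * suc (suc k) * (suc k * suc (suc k)) + suc k * (suc k + 1) * k * (3 * suc k + 2)
    ≡⟨ closedForm k ⟩
  suc (suc k) * (suc (suc k) + 1) * suc k * (3 * suc (suc k) + 2)
    ∎
  where
  open ≡-Reasoning
  expand : ∀ a x e → (a * x + e) * 24 ≡ 12 * a * (2 * x) + e * 24
  expand = solve-∀
  closedForm : ∀ k → 12 * suc (suc k) * (suc k * suc (suc k)) + suc k * (suc k + 1) * k * (3 * suc k + 2)
                   ≡ suc (suc k) * (suc (suc k) + 1) * suc k * (3 * suc (suc k) + 2)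
  closedForm = solve-∀

m≡multipartiteEdges : ∀ k → m k ≡ multipartiteEdges k
m≡multipartiteEdges zero    = refl
m≡multipartiteEdges (suc k) =
  trans (cong (_/ 24) (≡-sym (multipartiteEdges-suc*24 k))) (m*n/n≡m (multipartiteEdges (suc k)) 24)

MultiplicityAtMostValue : ∀ {n} → Vector ℕ n → Set
MultiplicityAtMostValue {n} w = ∀ a → ∑[ i < n ] 𝟙 (w i ≡ᵇ a) ≤ a

module _ {n} (G : Graph n) where

  adj< : Fin n → Fin n → Bool
  adj< i j = does (toℕ i <? toℕ j) ∧ adj G i j

  deg≡∑ : ∀ v → deg G v ≡ ∑[ u < n ] 𝟙 (adj G v u)
  deg≡∑ v = length-filter-tabulate (adj G v) id

  edgeCount≡∑ : edgeCount G ≡ ∑[ i < n ] ∑[ j < n ] 𝟙 (adj< i j)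
  edgeCount≡∑ = trans (sum-map-tabulate (λ i → length (filter (T? ∘ adj< i) (allFin n))) id)
                      (sum-cong-≗ λ i → length-filter-tabulate (adj< i) id)

  𝟙-adj≡𝟙-adj<+𝟙-adj> : ∀ i j → 𝟙 (adj G i j) ≡ 𝟙 (adj< i j) + 𝟙 (adj< j i)
  𝟙-adj≡𝟙-adj<+𝟙-adj> i j with <-cmpᶠ i j
  ... | tri< i<j _ j≮i
    rewrite dec-true (toℕ i <? toℕ j) i<j | dec-false (toℕ j <? toℕ i) j≮i
    = ≡-sym (+-identityʳ _)
  ... | tri> i≮j _ j<i
    rewrite dec-false (toℕ i <? toℕ j) i≮j | dec-true (toℕ j <? toℕ i) j<i
    = cong 𝟙 (sym G i j)
  ... | tri≈ i≮i refl _
    rewrite dec-false (toℕ i <? toℕ i) i≮i | irrefl G i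
    = refl

  ∑-deg≡2*edgeCount : ∑[ v < n ] deg G v ≡ 2 * edgeCount G
  ∑-deg≡2*edgeCount = begin
    ∑[ v < n ] deg G v
      ≡⟨ sum-cong-≗ deg≡∑ ⟩
    ∑[ i < n ] ∑[ j < n ] 𝟙 (adj G i j)
      ≡⟨ sum-cong-≗ (sum-cong-≗ ∘ 𝟙-adj≡𝟙-adj<+𝟙-adj>) ⟩
    ∑[ i < n ] ∑[ j < n ] (a i j + a j i)
      ≡⟨ sum-cong-≗ (λ i → ∑-distrib-+ (a i) (λ j → a j i)) ⟩
    ∑[ i < n ] (∑[ j < n ] a i j + ∑[ j < n ] a j i)
      ≡⟨ ∑-distrib-+ (λ i → ∑[ j < n ] a i j) _ ⟩
    E + ∑[ i < n ] ∑[ j < n ] a j i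
      ≡⟨ cong (E +_) (∑-comm (λ i j → a j i)) ⟩
    E + E
      ≡⟨ cong (E +_) (+-identityʳ E) ⟨
    2 * E
      ≡⟨ cong (2 *_) edgeCount≡∑ ⟨
    2 * edgeCount G
      ∎
    where
    open ≡-Reasoning
    a : Fin n → Fin n → ℕ
    a i j = 𝟙 (adj< i j)
    E : ℕ
    E = ∑[ i < n ] ∑[ j < n ] a i j

  2*edgeCount+∑≡n² : (w : Vector ℕ n) → (∀ v → deg G v + w v ≡ n) → 2 * edgeCount G + sum w ≡ n * n
  2*edgeCount+∑≡n² w deg+w≡n = begin
    2 * edgeCount G + sum w              ≡⟨ cong (_+ sum w) ∑-deg≡2*edgeCount ⟨
    ∑[ v < n ] deg G v + sum w           ≡⟨ ∑-distrib-+ (deg G) w ⟨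
    ∑[ v < n ] (deg G v + w v)           ≡⟨ sum-cong-≗ deg+w≡n ⟩
    ∑[ v < n ] n                         ≡⟨ ∑-const n n ⟩
    n * n                                ∎
    where open ≡-Reasoning

  codegree : Vector ℕ n
  codegree v = n ∸ deg G v

  deg≤n : ∀ v → deg G v ≤ n
  deg≤n v = subst (deg G v ≤_) (length-tabulate id) (length-filter (T? ∘ adj G v) (allFin n))

  deg+codegree≡n : ∀ v → deg G v + codegree v ≡ n
  deg+codegree≡n v = m+[n∸m]≡n (deg≤n v)

  nonNeighbours≤codegree : ∀ v (b : Fin n → Bool) → (∀ u → T (b u) → ¬ T (adj G v u)) →
                           ∑[ u < n ] 𝟙 (b u) ≤ codegree v
  nonNeighbours≤codegree v b nonAdj = m+n≤o⇒m≤o∸n _ (begin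
    ∑[ u < n ] 𝟙 (b u) + deg G v
      ≡⟨ cong (_ +_) (deg≡∑ v) ⟩
    ∑[ u < n ] 𝟙 (b u) + ∑[ u < n ] 𝟙 (adj G v u)
      ≡⟨ ∑-distrib-+ (𝟙 ∘ b) (𝟙 ∘ adj G v) ⟨
    ∑[ u < n ] (𝟙 (b u) + 𝟙 (adj G v u))
      ≤⟨ ∑-mono-≤ (λ u → atMostOne (b u) (adj G v u) (nonAdj u)) ⟩
    ∑[ u < n ] 1
      ≡⟨ ∑-const n 1 ⟩
    n * 1
      ≡⟨ *-identityʳ n ⟩
    n ∎)
    where
    open ≤-Reasoning
    atMostOne : ∀ x y → (T x → ¬ T y) → 𝟙 x + 𝟙 y ≤ 1
    atMostOne true  true  x⇒¬y = contradiction _ (x⇒¬y _)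
    atMostOne true  false _    = ≤-refl
    atMostOne false true  _    = ≤-refl
    atMostOne false false _    = z≤n

  codegree-injective : ∀ {u v} → codegree u ≡ codegree v → deg G u ≡ deg G v
  codegree-injective {u} {v} cu≡cv = +-cancelʳ-≡ (codegree v) _ _ (begin
    deg G u + codegree v  ≡⟨ cong (deg G u +_) cu≡cv ⟨
    deg G u + codegree u  ≡⟨ deg+codegree≡n u ⟩
    n                     ≡⟨ deg+codegree≡n v ⟨
    deg G v + codegree v  ∎)
    where open ≡-Reasoning

  codegree-multiplicity : LocallyIrregular G → MultiplicityAtMostValue codegree
  codegree-multiplicity irregular a with any? (λ v → T? (codegree v ≡ᵇ a))
  ... | yes (v , cv≡a) = subst (∑[ u < n ] 𝟙 (codegree u ≡ᵇ a) ≤_) (≡ᵇ⇒≡ (codegree v) a cv≡a)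
                               (nonNeighbours≤codegree v (λ u → codegree u ≡ᵇ a) nonAdj)
    where
    nonAdj : ∀ u → T (codegree u ≡ᵇ a) → ¬ T (adj G v u)
    nonAdj u cu≡a vu = irregular v u vu
      (codegree-injective (trans (≡ᵇ⇒≡ (codegree v) a cv≡a) (≡-sym (≡ᵇ⇒≡ (codegree u) a cu≡a))))
  ... | no none = ≤-trans (≤-reflexive (∑-zero λ u → 𝟙-false λ cu≡a → none (u , cu≡a))) z≤n

module _ {n} (w : Vector ℕ n) (multiplicity≤ : MultiplicityAtMostValue w) where

  count< : ℕ → ℕ
  count< k = ∑[ i < n ] 𝟙 (w i <ᵇ k)

  count<-suc : ∀ k → count< (suc k) ≡ ∑[ i < n ] 𝟙 (w i ≡ᵇ k) + count< k
  count<-suc k = trans (sum-cong-≗ (λ i → 𝟙-<ᵇ-suc (w i) k))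
                       (∑-distrib-+ (λ i → 𝟙 (w i ≡ᵇ k)) (λ i → 𝟙 (w i <ᵇ k)))

  count<suc≤t : ∀ k → count< (suc k) ≤ t k
  count<suc≤t zero = begin
    count< 1                            ≡⟨ count<-suc 0 ⟩
    ∑[ i < n ] 𝟙 (w i ≡ᵇ 0) + count< 0  ≤⟨ +-mono-≤ (multiplicity≤ 0) (≤-reflexive (sum-replicate-zero n)) ⟩
    0                                   ∎
    where open ≤-Reasoning
  count<suc≤t (suc k) = begin
    count< (suc (suc k))                            ≡⟨ count<-suc (suc k) ⟩
    ∑[ i < n ] 𝟙 (w i ≡ᵇ suc k) + count< (suc k)    ≤⟨ +-mono-≤ (multiplicity≤ (suc k)) (count<suc≤t k) ⟩
    suc k + t k                                     ∎
    where open ≤-Reasoning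

  -- k ∸ w i counts the j < k with w i ≤ j, and for each j at most t j indices have w i ≤ j.
  ∑-∸≤tetrahedral : ∀ k → ∑[ i < n ] (k ∸ w i) ≤ tetrahedral k
  ∑-∸≤tetrahedral zero = ≤-reflexive (∑-zero (λ i → 0∸n≡0 (w i)))
  ∑-∸≤tetrahedral (suc k) = begin
    ∑[ i < n ] (suc k ∸ w i)                   ≡⟨ sum-cong-≗ (λ i → suc-∸ (w i) k) ⟩
    ∑[ i < n ] (𝟙 (w i <ᵇ suc k) + (k ∸ w i))  ≡⟨ ∑-distrib-+ (λ i → 𝟙 (w i <ᵇ suc k)) (λ i → k ∸ w i) ⟩
    count< (suc k) + ∑[ i < n ] (k ∸ w i)      ≤⟨ +-mono-≤ (count<suc≤t k) (∑-∸≤tetrahedral k) ⟩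
    t k + tetrahedral k                        ∎
    where open ≤-Reasoning

  k*n≤∑+tetrahedral : ∀ k → k * n ≤ sum w + tetrahedral k
  k*n≤∑+tetrahedral k = begin
    k * n                              ≡⟨ *-comm k n ⟩
    n * k                              ≡⟨ ∑-const n k ⟨
    ∑[ i < n ] k                       ≤⟨ ∑-mono-≤ (λ i → m≤n+m∸n k (w i)) ⟩
    ∑[ i < n ] (w i + (k ∸ w i))       ≡⟨ ∑-distrib-+ w (λ i → k ∸ w i) ⟩
    sum w + ∑[ i < n ] (k ∸ w i)       ≤⟨ +-monoʳ-≤ (sum w) (∑-∸≤tetrahedral k) ⟩
    sum w + tetrahedral k              ∎
    where open ≤-Reasoning

sumSquares≤∑ : ∀ k (w : Vector ℕ (t k)) → MultiplicityAtMostValue w → sumSquares k ≤ sum w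
sumSquares≤∑ k w multiplicity≤ = +-cancelʳ-≤ (tetrahedral k) _ _ (begin
  sumSquares k + tetrahedral k  ≡⟨ k*t≡sumSquares+tetrahedral k ⟨
  k * t k                       ≤⟨ k*n≤∑+tetrahedral w multiplicity≤ k ⟩
  sum w + tetrahedral k         ∎)
  where open ≤-Reasoning

completeMultipartite : ∀ {n} → Vector ℕ n → Graph n
completeMultipartite c = record
  { adj    = λ i j → not (c i ≡ᵇ c j)
  ; sym    = λ i j → cong not (≡ᵇ-sym (c i) (c j))
  ; irrefl = λ i → cong not (≡ᵇ-refl (c i))
  }

module _ {n} (c : Vector ℕ n) where

  classSize : Fin n → ℕ
  classSize v = ∑[ u < n ] 𝟙 (c v ≡ᵇ c u)

  deg+classSize≡n : ∀ v → deg (completeMultipartite c) v + classSize v ≡ n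
  deg+classSize≡n v = begin
    deg (completeMultipartite c) v + classSize v
      ≡⟨ cong (_+ classSize v) (deg≡∑ (completeMultipartite c) v) ⟩
    ∑[ u < n ] 𝟙 (not (c v ≡ᵇ c u)) + classSize v
      ≡⟨ ∑-distrib-+ (λ u → 𝟙 (not (c v ≡ᵇ c u))) (λ u → 𝟙 (c v ≡ᵇ c u)) ⟨
    ∑[ u < n ] (𝟙 (not (c v ≡ᵇ c u)) + 𝟙 (c v ≡ᵇ c u))
      ≡⟨ sum-cong-≗ (λ u → 𝟙-not+𝟙 (c v ≡ᵇ c u)) ⟩
    ∑[ u < n ] 1
      ≡⟨ ∑-const n 1 ⟩
    n * 1
      ≡⟨ *-identityʳ n ⟩
    n ∎
    where open ≡-Reasoning

  completeMultipartite-locallyIrregular : (∀ v → classSize v ≡ c v) →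
                                          LocallyIrregular (completeMultipartite c)
  completeMultipartite-locallyIrregular classSize≡c u v uv du≡dv =
    subst (T ∘ not) (trans (cong (_≡ᵇ c v) cu≡cv) (≡ᵇ-refl (c v))) uv
    where
    open ≡-Reasoning
    deg′ : Fin n → ℕ
    deg′ = deg (completeMultipartite c)
    cu≡cv : c u ≡ c v
    cu≡cv = +-cancelˡ-≡ (deg′ u) _ _ (begin
      deg′ u + c u          ≡⟨ cong (deg′ u +_) (classSize≡c u) ⟨
      deg′ u + classSize u  ≡⟨ deg+classSize≡n u ⟩
      n                     ≡⟨ deg+classSize≡n v ⟨
      deg′ v + classSize v  ≡⟨ cong₂ _+_ (≡-sym du≡dv) (classSize≡c v) ⟩
      deg′ u + c v          ∎)

-- Each vertex of K_{1,2,…,k} is coloured by the size of its part.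
partSizes : ∀ k → Vector ℕ (t k)
partSizes zero    = λ ()
partSizes (suc k) = replicate (suc k) (suc k) ++ partSizes k

∑-partSizes : ∀ k (g : ℕ → ℕ) →
              ∑[ i < t (suc k) ] g (partSizes (suc k) i) ≡ suc k * g (suc k) + ∑[ i < t k ] g (partSizes k i)
∑-partSizes k g = begin
  sum (g ∘ (replicate (suc k) (suc k) ++ partSizes k))
    ≡⟨ sum-cong-≗ ([,]-∘ g {replicate (suc k) (suc k)} {partSizes k} ∘ splitAt (suc k)) ⟩
  sum ((g ∘ replicate (suc k) (suc k)) ++ (g ∘ partSizes k))
    ≡⟨ ∑-++ (g ∘ replicate (suc k) (suc k)) (g ∘ partSizes k) ⟩
  ∑[ i < suc k ] g (suc k) + sum (g ∘ partSizes k)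
    ≡⟨ cong (_+ sum (g ∘ partSizes k)) (∑-const (suc k) (g (suc k))) ⟩
  suc k * g (suc k) + sum (g ∘ partSizes k)
    ∎
  where open ≡-Reasoning

∑-partSizes≡sumSquares : ∀ k → sum (partSizes k) ≡ sumSquares k
∑-partSizes≡sumSquares zero    = refl
∑-partSizes≡sumSquares (suc k) =
  trans (∑-partSizes k id) (cong (suc k * suc k +_) (∑-partSizes≡sumSquares k))

partSizes≤ : ∀ k i → partSizes k i ≤ k
partSizes≤ (suc k) i with splitAt (suc k) i
... | inj₁ _ = ≤-refl
... | inj₂ j = m≤n⇒m≤1+n (partSizes≤ k j)

partSizes-absent : ∀ k s → k < s → ∑[ j < t k ] 𝟙 (s ≡ᵇ partSizes k j) ≡ 0
partSizes-absent k s k<s =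
  ∑-zero λ j → 𝟙-≡ᵇ-≢ λ s≡p → <⇒≱ k<s (subst (_≤ k) (≡-sym s≡p) (partSizes≤ k j))

partSizes-classSize : ∀ k i → classSize (partSizes k) i ≡ partSizes k i
partSizes-classSize zero    ()
partSizes-classSize (suc k) i = begin
  ∑[ j < t (suc k) ] 𝟙 (p ≡ᵇ partSizes (suc k) j)                ≡⟨ ∑-partSizes k (λ q → 𝟙 (p ≡ᵇ q)) ⟩
  suc k * 𝟙 (p ≡ᵇ suc k) + ∑[ j < t k ] 𝟙 (p ≡ᵇ partSizes k j) ≡⟨ byBlock (splitAt (suc k) i) ⟩
  p                                                              ∎
  where
  open ≡-Reasoning
  p : ℕ
  p = partSizes (suc k) i
  byBlock : ∀ b → let q = [ (λ _ → suc k) , partSizes k ] b in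
            suc k * 𝟙 (q ≡ᵇ suc k) + ∑[ j < t k ] 𝟙 (q ≡ᵇ partSizes k j) ≡ q
  byBlock (inj₁ _) = trans
    (cong₂ _+_ (cong ((suc k *_) ∘ 𝟙) (≡ᵇ-refl k)) (partSizes-absent k (suc k) ≤-refl))
    (trans (+-identityʳ _) (*-identityʳ (suc k)))
  byBlock (inj₂ j) = cong₂ _+_
    (trans (cong (suc k *_) (𝟙-≡ᵇ-≢ (<⇒≢ (s≤s (partSizes≤ k j))))) (*-zeroʳ (suc k)))
    (partSizes-classSize k j)

K : ∀ k → Graph (t k)
K k = completeMultipartite (partSizes k)

K-locallyIrregular : ∀ k → LocallyIrregular (K k)
K-locallyIrregular k = completeMultipartite-locallyIrregular (partSizes k) (partSizes-classSize k)

edgeCount-K : ∀ k → edgeCount (K k) ≡ multipartiteEdges k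
edgeCount-K k = *-cancelˡ-≡ _ _ 2 (+-cancelʳ-≡ (sumSquares k) _ _ (begin
  2 * edgeCount (K k) + sumSquares k
    ≡⟨ cong (2 * edgeCount (K k) +_) (∑-partSizes≡sumSquares k) ⟨
  2 * edgeCount (K k) + sum (partSizes k)
    ≡⟨ 2*edgeCount+∑≡n² (K k) (partSizes k) deg+partSize≡t ⟩
  t k * t k
    ≡⟨ 2*multipartiteEdges+sumSquares≡t² k ⟨
  2 * multipartiteEdges k + sumSquares k
    ∎))
  where
  open ≡-Reasoning
  deg+partSize≡t : ∀ v → deg (K k) v + partSizes k v ≡ t k
  deg+partSize≡t v =
    trans (cong (deg (K k) v +_) (≡-sym (partSizes-classSize k v))) (deg+classSize≡n (partSizes k) v)

edgeCount≤multipartiteEdges : ∀ k (G : Graph (t k)) → LocallyIrregular G → edgeCount G ≤ multipartiteEdges k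
edgeCount≤multipartiteEdges k G irregular = *-cancelˡ-≤ 2 (+-cancelʳ-≤ (sumSquares k) _ _ (begin
  2 * edgeCount G + sumSquares k
    ≤⟨ +-monoʳ-≤ (2 * edgeCount G) (sumSquares≤∑ k (codegree G) (codegree-multiplicity G irregular)) ⟩
  2 * edgeCount G + sum (codegree G)
    ≡⟨ 2*edgeCount+∑≡n² G (codegree G) (deg+codegree≡n G) ⟩
  t k * t k
    ≡⟨ 2*multipartiteEdges+sumSquares≡t² k ⟨
  2 * multipartiteEdges k + sumSquares k
    ∎))
  where open ≤-Reasoning

lemma4 : (k : ℕ) → 1 ≤ k →
    (Σ (Graph (t k)) (λ G → LocallyIrregular G × edgeCount G ≡ m k))
    × ((G : Graph (t k)) → LocallyIrregular G → edgeCount G ≤ m k)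
lemma4 k _ rewrite m≡multipartiteEdges k =
  (K k , K-locallyIrregular k , edgeCount-K k) , edgeCount≤multipartiteEdges k
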